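{- Let $\sigma,\tau$ be types with disjunctive weak normal forms $w(\sigma)=\bigvee_{i\in I}(\bigwedge_{h\in H_i}\alpha^{(i)}_h)$ and $w(\tau)=\bigvee_{j\in J}(\bigwedge_{k\in K_j}\beta^{(j)}_k)$, with all $\alpha^{(i)}_h,\beta^{(j)}_k$ atomic or arrow types. If $x:\sigma\vdash x:\tau$, then for every $i\in I$ there is $j_i\in J$ such that $\{\beta^{(j_i)}_k\mid k\in K_{j_i}\}\subseteq\{\alpha^{(i)}_h\mid h\in H_i\}$; in particular $x:\bigwedge_{h\in H_i}\alpha^{(i)}_h\vdash x:\bigwedge_{k\in K_{j_i}}\beta^{(j_i)}_k$.
   Context: Types: $\sigma ::= \varphi \mid \sigma\to\sigma \mid \sigma\wedge\sigma \mid \sigma\vee\sigma$ ($\varphi$ atomic); at top level $\wedge,\vee$ are taken modulo associativity, commutativity, idempotence. Disjunctive weak normal form: $w(\alpha)=\alpha$ for atomic or arrow $\alpha$; $w(\sigma\vee\tau)=w(\sigma)\vee w(\tau)$; if $w(\sigma)=\bigvee_i\mu_i$, $w(\tau)=\bigvee_j\nu_j$ then $w(\sigma\wedge\tau)=\bigvee_{i,j}(\mu_i\wedge\nu_j)$. Typing of linear $\lambda$-terms (each variable occurs exactly once): (Ax) $x:\sigma\vdash x:\sigma$; ($\to$I) from $\Gamma,x:\sigma\vdash M:\tau$ infer $\Gamma\vdash\lambda x.M:\sigma\to\tau$; ($\to$E) from $\Gamma_1\vdash M:\sigma\to\tau$, $\Gamma_2\vdash N:\sigma$ infer $\Gamma_1,\Gamma_2\vdash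 MN:\tau$; ($\wedge$I) from $\Gamma\vdash M:\sigma$, $\Gamma\vdash M:\tau$ infer $\Gamma\vdash M:\sigma\wedge\tau$; ($\wedge$E) from $\Gamma\vdash M:\sigma\wedge\tau$ infer $\Gamma\vdash M:\sigma$ and $\Gamma\vdash M:\tau$; ($\vee$I) from $\Gamma\vdash M:\sigma$ infer $\Gamma\vdash M:\sigma\vee\tau$ and $\Gamma\vdash M:\tau\vee\sigma$; ($\vee$E) from $\Gamma_1,x:\sigma\wedge\theta\vdash M:\rho$, $\Gamma_1,x:\tau\wedge\theta\vdash M:\rho$, $\Gamma_2\vdash N:(\sigma\vee\tau)\wedge\theta$ infer $\Gamma_1,\Gamma_2\vdash M[N/x]:\rho$ (environments: finite sets of $x:\sigma$, distinct variables; $\Gamma_1,\Gamma_2$ disjoint). -}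

module Defs where

open import Data.Nat using (ℕ; _≟_)
open import Data.List using (List; []; _∷_; _++_; map; filter)
open import Data.List.NonEmpty as L⁺ using (List⁺; _⁺++⁺_; foldr₁; toList)
open import Data.List.Membership.Propositional using (_∈_; _∉_)
open import Data.List.Relation.Unary.Unique.Propositional using (Unique)
open import Data.List.Relation.Binary.Permutation.Propositional using (_↭_)
open import Data.List.Relation.Binary.Pointwise using (Pointwise)
open import Data.Product using (_×_; _,_; proj₁; proj₂)
open import Relation.Binary.PropositionalEquality using (_≡_)
open import Relation.Nullary using (¬_; yes; no; ¬?)
open import Relation.Nullary.Decidable using (does)
open import Data.Bool using (if_then_else_)

infixr 5 _⇒_
infixl 7 _∧_
infixl 6 _∨_

data Ty : Set where
  atom : ℕ → Ty
  _⇒_  : Ty → Ty → Ty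
  _∧_  : Ty → Ty → Ty
  _∨_  : Ty → Ty → Ty

infix 4 _≈_
data _≈_ : Ty → Ty → Set where
  ≈-refl   : ∀ {σ} → σ ≈ σ
  ≈-sym    : ∀ {σ τ} → σ ≈ τ → τ ≈ σ
  ≈-trans  : ∀ {σ τ ρ} → σ ≈ τ → τ ≈ ρ → σ ≈ ρ
  ∧-cong   : ∀ {σ σ' τ τ'} → σ ≈ σ' → τ ≈ τ' → σ ∧ τ ≈ σ' ∧ τ'
  ∨-cong   : ∀ {σ σ' τ τ'} → σ ≈ σ' → τ ≈ τ' → σ ∨ τ ≈ σ' ∨ τ'
  ∧-assoc  : ∀ {σ τ ρ} → (σ ∧ τ) ∧ ρ ≈ σ ∧ (τ ∧ ρ)
  ∧-comm   : ∀ {σ τ} → σ ∧ τ ≈ τ ∧ σ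
  ∧-idem   : ∀ {σ} → σ ∧ σ ≈ σ
  ∨-assoc  : ∀ {σ τ ρ} → (σ ∨ τ) ∨ ρ ≈ σ ∨ (τ ∨ ρ)
  ∨-comm   : ∀ {σ τ} → σ ∨ τ ≈ τ ∨ σ
  ∨-idem   : ∀ {σ} → σ ∨ σ ≈ σ

-- Disjunctive weak normal form, represented as a nonempty list
-- (disjunction) of nonempty lists (conjunctions) of atomic/arrow types.

w : Ty → List⁺ (List⁺ Ty)
w (atom φ) = L⁺.[ L⁺.[ atom φ ] ]
w (σ ⇒ τ)  = L⁺.[ L⁺.[ σ ⇒ τ ] ]
w (σ ∨ τ)  = w σ ⁺++⁺ w τ
w (σ ∧ τ)  = L⁺.concatMap (λ μ → L⁺.map (λ ν → μ ⁺++⁺ ν) (w τ)) (w σ)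

⋀ : List⁺ Ty → Ty
⋀ = foldr₁ _∧_

Var : Set
Var = ℕ

data Tm : Set where
  var : Var → Tm
  lam : Var → Tm → Tm
  app : Tm → Tm → Tm

remove : Var → List Var → List Var
remove x = filter (λ y → ¬? (y ≟ x))

FV : Tm → List Var
FV (var x)   = x ∷ []
FV (lam x M) = remove x (FV M)
FV (app M N) = FV M ++ FV N

BV : Tm → List Var
BV (var x)   = []
BV (lam x M) = x ∷ BV M
BV (app M N) = BV M ++ BV N

-- M [ N / x ]  (used only under the side condition that no bound
-- variable of M is free in N, so it is capture-avoiding)
_[_/_] : Tm → Tm → Var → Tm
var y [ N / x ] = if does (y ≟ x) then N else var y
lam y M [ N / x ] = if does (y ≟ x) then lam y M else lam y (M [ N / x ])
app M₁ M₂ [ N / x ] = app (M₁ [ N / x ]) (M₂ [ N / x ])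

-- Environments: finite sets of declarations x : σ with distinct variables,
-- represented as lists (order irrelevant via the exchange rule).

Env : Set
Env = List (Var × Ty)

dom : Env → List Var
dom = map proj₁

EnvEq : Env → Env → Set
EnvEq = Pointwise (λ p q → (proj₁ p ≡ proj₁ q) × (proj₂ p ≈ proj₂ q))

infix 3 _⊢_∶_
data _⊢_∶_ : Env → Tm → Ty → Set where
  ax   : ∀ {x σ} → ((x , σ) ∷ []) ⊢ var x ∶ σ
  →I   : ∀ {Γ x σ M τ} → x ∉ dom Γ →
         ((x , σ) ∷ Γ) ⊢ M ∶ τ → Γ ⊢ lam x M ∶ σ ⇒ τ
  →E   : ∀ {Γ₁ Γ₂ M N σ τ} → Unique (dom (Γ₁ ++ Γ₂)) →
         Γ₁ ⊢ M ∶ σ ⇒ τ → Γ₂ ⊢ N ∶ σ → (Γ₁ ++ Γ₂) ⊢ app M N ∶ τ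
  ∧I   : ∀ {Γ M σ τ} → Γ ⊢ M ∶ σ → Γ ⊢ M ∶ τ → Γ ⊢ M ∶ σ ∧ τ
  ∧E₁  : ∀ {Γ M σ τ} → Γ ⊢ M ∶ σ ∧ τ → Γ ⊢ M ∶ σ
  ∧E₂  : ∀ {Γ M σ τ} → Γ ⊢ M ∶ σ ∧ τ → Γ ⊢ M ∶ τ
  ∨I₁  : ∀ {Γ M σ τ} → Γ ⊢ M ∶ σ → Γ ⊢ M ∶ σ ∨ τ
  ∨I₂  : ∀ {Γ M σ τ} → Γ ⊢ M ∶ σ → Γ ⊢ M ∶ τ ∨ σ
  ∨E   : ∀ {Γ₁ Γ₂ x M N σ τ θ ρ} →
         x ∉ dom Γ₁ → Unique (dom (Γ₁ ++ Γ₂)) →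
         (∀ {y} → y ∈ BV M → y ∉ FV N) →
         ((x , σ ∧ θ) ∷ Γ₁) ⊢ M ∶ ρ →
         ((x , τ ∧ θ) ∷ Γ₁) ⊢ M ∶ ρ →
         Γ₂ ⊢ N ∶ (σ ∨ τ) ∧ θ →
         (Γ₁ ++ Γ₂) ⊢ M [ N / x ] ∶ ρ
  exch : ∀ {Γ Γ' M σ} → Γ ⊢ M ∶ σ → Γ ↭ Γ' → Γ' ⊢ M ∶ σ
  -- types are taken modulo ACI of ∧, ∨ at top level
  conv : ∀ {Γ M σ σ'} → Γ ⊢ M ∶ σ → σ ≈ σ' → Γ ⊢ M ∶ σ'
  convΓ : ∀ {Γ Γ' M σ} → Γ ⊢ M ∶ σ → EnvEq Γ Γ' → Γ' ⊢ M ∶ σ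

-- Read a type as a proposition over its prime components (atoms and
-- arrows), with ∧ as conjunction and ∨ as disjunction.  Every rule that can
-- type a bare variable is sound for this reading, so x : σ ⊢ x : τ gives
-- σ ⊨ τ.  A disjunct μ of w σ satisfies σ under the valuation "β ∈ μ", hence
-- satisfies τ, and a satisfied type always has a disjunct of its weak normal
-- form whose members are all satisfied, i.e. a disjunct ν ⊆ μ of w τ.

module Submission where

open import Defs
open import Data.Nat using (_≟_)
open import Data.List using (_∷_; [])
import Data.List as List
open import Data.List.NonEmpty using (toList; _⁺++⁺_)
import Data.List.NonEmpty as List⁺
open import Data.List.Membership.Propositional using (_∈_)
open import Data.List.Membership.Propositional.Properties
  using (∈-++⁺ˡ; ∈-++⁺ʳ; ∈-++⁻; ∈-map⁺; ∈-map⁻; ∈-concat⁺′; ∈-concat⁻′)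
open import Data.List.Relation.Unary.Any using (here; there)
open import Data.List.Relation.Binary.Pointwise using (_∷_; [])
open import Data.List.Relation.Binary.Permutation.Propositional using (↭-sym)
open import Data.List.Relation.Binary.Permutation.Propositional.Properties using (↭-singleton-inv)
open import Data.Product using (Σ; _×_; _,_; proj₁; proj₂)
open import Data.Product.Algebra using (×-assoc; ×-comm)
open import Data.Product.Function.NonDependent.Propositional using (_×-cong_)
open import Data.Sum using (_⊎_; inj₁; inj₂; [_,_])
open import Data.Sum.Algebra using (⊎-assoc; ⊎-comm)
open import Data.Sum.Function.Propositional using (_⊎-cong_)
open import Data.Bool using (true; false)
open import Data.Empty using (⊥-elim)
open import Function using (id; _∘_; _⇔_; mk⇔; Equivalence)
import Function.Properties.Equivalence as ⇔
open import Function.Properties.Inverse using (↔⇒⇔)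
open import Relation.Nullary using (yes; no; ¬_)
open import Relation.Nullary.Decidable using (does; dec-true; dec-false)
open import Relation.Binary.PropositionalEquality using (_≡_; refl; sym; trans)

open Equivalence using (to; from)

⟦_⟧ : Ty → (Ty → Set) → Set
⟦ atom φ ⟧ S = S (atom φ)
⟦ σ ⇒ τ ⟧ S = S (σ ⇒ τ)
⟦ σ ∧ τ ⟧ S = ⟦ σ ⟧ S × ⟦ τ ⟧ S
⟦ σ ∨ τ ⟧ S = ⟦ σ ⟧ S ⊎ ⟦ τ ⟧ S

⟦⟧-map : ∀ σ {S S′ : Ty → Set} → (∀ {β} → S β → S′ β) → ⟦ σ ⟧ S → ⟦ σ ⟧ S′
⟦⟧-map (atom φ) f p        = f p
⟦⟧-map (σ ⇒ τ)  f p        = f p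
⟦⟧-map (σ ∧ τ)  f (p , q)  = ⟦⟧-map σ f p , ⟦⟧-map τ f q
⟦⟧-map (σ ∨ τ)  f (inj₁ p) = inj₁ (⟦⟧-map σ f p)
⟦⟧-map (σ ∨ τ)  f (inj₂ q) = inj₂ (⟦⟧-map τ f q)

≈⇒⟦⟧⇔ : ∀ {σ τ} {S : Ty → Set} → σ ≈ τ → ⟦ σ ⟧ S ⇔ ⟦ τ ⟧ S
≈⇒⟦⟧⇔ ≈-refl       = ⇔.refl
≈⇒⟦⟧⇔ (≈-sym e)     = ⇔.sym (≈⇒⟦⟧⇔ e)
≈⇒⟦⟧⇔ (≈-trans e f) = ⇔.trans (≈⇒⟦⟧⇔ e) (≈⇒⟦⟧⇔ f)
≈⇒⟦⟧⇔ (∧-cong e f)  = ≈⇒⟦⟧⇔ e ×-cong ≈⇒⟦⟧⇔ f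
≈⇒⟦⟧⇔ (∨-cong e f)  = ≈⇒⟦⟧⇔ e ⊎-cong ≈⇒⟦⟧⇔ f
≈⇒⟦⟧⇔ ∧-assoc       = ↔⇒⇔ (×-assoc _ _ _ _)
≈⇒⟦⟧⇔ ∧-comm        = ↔⇒⇔ (×-comm _ _)
≈⇒⟦⟧⇔ ∧-idem        = mk⇔ proj₁ (λ p → p , p)
≈⇒⟦⟧⇔ ∨-assoc       = ↔⇒⇔ (⊎-assoc _ _ _ _)
≈⇒⟦⟧⇔ ∨-comm        = ↔⇒⇔ (⊎-comm _ _)
≈⇒⟦⟧⇔ ∨-idem        = mk⇔ [ id , id ] inj₁

infix 4 _⊨_
record _⊨_ (σ ρ : Ty) : Set₁ where
  constructor entails
  field apply : ∀ S → ⟦ σ ⟧ S → ⟦ ρ ⟧ S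
open _⊨_

⊨-trans : ∀ {σ τ ρ} → σ ⊨ τ → τ ⊨ ρ → σ ⊨ ρ
⊨-trans f g = entails λ S → apply g S ∘ apply f S

⊨-∨-∧-elim : ∀ {σ τ θ ρ} → σ ∧ θ ⊨ ρ → τ ∧ θ ⊨ ρ → (σ ∨ τ) ∧ θ ⊨ ρ
⊨-∨-∧-elim f g = entails λ where
  S (inj₁ p , r) → apply f S (p , r)
  S (inj₂ q , r) → apply g S (q , r)

∈-w-∧⁻ : ∀ σ τ {μ} → μ ∈ toList (w (σ ∧ τ)) →
         Σ _ λ μ₁ → Σ _ λ μ₂ → μ₁ ∈ toList (w σ) × μ₂ ∈ toList (w τ) × μ ≡ μ₁ ⁺++⁺ μ₂
∈-w-∧⁻ σ τ p
  with ∈-concat⁻′ (List.map toList (List.map (λ μ → List⁺.map (μ ⁺++⁺_) (w τ)) (toList (w σ)))) p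
... | _ , p₁ , p₂ with ∈-map⁻ toList p₂
... | _ , p₃ , refl with ∈-map⁻ (λ μ → List⁺.map (μ ⁺++⁺_) (w τ)) p₃
... | μ₁ , μ₁∈ , refl with ∈-map⁻ (μ₁ ⁺++⁺_) p₁
... | μ₂ , μ₂∈ , refl = μ₁ , μ₂ , μ₁∈ , μ₂∈ , refl

∈-w-∧⁺ : ∀ σ τ {μ₁ μ₂} → μ₁ ∈ toList (w σ) → μ₂ ∈ toList (w τ) → μ₁ ⁺++⁺ μ₂ ∈ toList (w (σ ∧ τ))
∈-w-∧⁺ σ τ {μ₁} p q =
  ∈-concat⁺′ (∈-map⁺ (μ₁ ⁺++⁺_) q) (∈-map⁺ toList (∈-map⁺ (λ μ → List⁺.map (μ ⁺++⁺_) (w τ)) p))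

∈-w⇒⟦⟧ : ∀ σ {μ} → μ ∈ toList (w σ) → ⟦ σ ⟧ (_∈ toList μ)
∈-w⇒⟦⟧ (atom φ) (here refl) = here refl
∈-w⇒⟦⟧ (σ ⇒ τ)  (here refl) = here refl
∈-w⇒⟦⟧ (σ ∨ τ)  p with ∈-++⁻ (toList (w σ)) p
... | inj₁ q = inj₁ (∈-w⇒⟦⟧ σ q)
... | inj₂ q = inj₂ (∈-w⇒⟦⟧ τ q)
∈-w⇒⟦⟧ (σ ∧ τ)  p with ∈-w-∧⁻ σ τ p
... | μ₁ , _ , p₁ , p₂ , refl =
  ⟦⟧-map σ ∈-++⁺ˡ (∈-w⇒⟦⟧ σ p₁) , ⟦⟧-map τ (∈-++⁺ʳ (toList μ₁)) (∈-w⇒⟦⟧ τ p₂)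

⟦⟧⇒∈-w : ∀ τ {S : Ty → Set} → ⟦ τ ⟧ S →
         Σ _ λ ν → ν ∈ toList (w τ) × (∀ {β} → β ∈ toList ν → S β)
⟦⟧⇒∈-w (atom φ) s = _ , here refl , λ { (here refl) → s }
⟦⟧⇒∈-w (σ ⇒ τ)  s = _ , here refl , λ { (here refl) → s }
⟦⟧⇒∈-w (σ ∨ τ)  (inj₁ s) with ⟦⟧⇒∈-w σ s
... | ν , ν∈ , sat = ν , ∈-++⁺ˡ ν∈ , sat
⟦⟧⇒∈-w (σ ∨ τ)  (inj₂ s) with ⟦⟧⇒∈-w τ s
... | ν , ν∈ , sat = ν , ∈-++⁺ʳ (toList (w σ)) ν∈ , sat
⟦⟧⇒∈-w (σ ∧ τ)  (s , t) with ⟦⟧⇒∈-w σ s | ⟦⟧⇒∈-w τ t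
... | ν₁ , ν₁∈ , sat₁ | ν₂ , ν₂∈ , sat₂ =
  ν₁ ⁺++⁺ ν₂ , ∈-w-∧⁺ σ τ ν₁∈ ν₂∈ , [ sat₁ , sat₂ ] ∘ ∈-++⁻ (toList ν₁)

var[/]-same : ∀ x N → var x [ N / x ] ≡ N
var[/]-same x N rewrite dec-true (x ≟ x) refl = refl

var[/]-other : ∀ {y x} N → ¬ y ≡ x → var y [ N / x ] ≡ var y
var[/]-other {y} {x} N y≢x rewrite dec-false (y ≟ x) y≢x = refl

[/]≡var⁻ : ∀ M N x z → M [ N / x ] ≡ var z → (M ≡ var x × N ≡ var z) ⊎ (M ≡ var z × ¬ z ≡ x)
[/]≡var⁻ (var y) N x z eq with y ≟ x
... | yes refl = inj₁ (refl , trans (sym (var[/]-same y N)) eq)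
... | no y≢x with trans (sym (var[/]-other N y≢x)) eq
...   | refl = inj₂ (refl , y≢x)
[/]≡var⁻ (lam y M) N x z eq with does (y ≟ x) | eq
... | true  | ()
... | false | ()

⊢var⇒⊨ : ∀ {Γ M ρ z} → Γ ⊢ M ∶ ρ → M ≡ var z → Σ Ty λ σ → Γ ≡ (z , σ) ∷ [] × σ ⊨ ρ
⊢var⇒⊨ ax refl = _ , refl , entails λ _ → id
⊢var⇒⊨ (∧I d e) eq with ⊢var⇒⊨ d eq | ⊢var⇒⊨ e eq
... | σ , refl , f | _ , refl , g = σ , refl , entails λ S p → apply f S p , apply g S p
⊢var⇒⊨ (∧E₁ d) eq with ⊢var⇒⊨ d eq
... | σ , Γ≡ , f = σ , Γ≡ , entails λ S → proj₁ ∘ apply f S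
⊢var⇒⊨ (∧E₂ d) eq with ⊢var⇒⊨ d eq
... | σ , Γ≡ , f = σ , Γ≡ , entails λ S → proj₂ ∘ apply f S
⊢var⇒⊨ (∨I₁ d) eq with ⊢var⇒⊨ d eq
... | σ , Γ≡ , f = σ , Γ≡ , entails λ S → inj₁ ∘ apply f S
⊢var⇒⊨ (∨I₂ d) eq with ⊢var⇒⊨ d eq
... | σ , Γ≡ , f = σ , Γ≡ , entails λ S → inj₂ ∘ apply f S
⊢var⇒⊨ (∨E {M = M} {N} _ _ _ d₁ d₂ dN) eq with [/]≡var⁻ M N _ _ eq
... | inj₁ (refl , N≡z) with ⊢var⇒⊨ d₁ refl | ⊢var⇒⊨ d₂ refl | ⊢var⇒⊨ dN N≡z
...   | _ , refl , f₁ | _ , refl , f₂ | σ , refl , g = σ , refl , ⊨-trans g (⊨-∨-∧-elim f₁ f₂)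
⊢var⇒⊨ (∨E _ _ _ d₁ _ _) eq | inj₂ (refl , z≢x) with ⊢var⇒⊨ d₁ refl
  -- the premise context of the substituted variable z would contain x
...   | _ , refl , _ = ⊥-elim (z≢x refl)
⊢var⇒⊨ (exch d π) eq with ⊢var⇒⊨ d eq
... | σ , refl , f = σ , ↭-singleton-inv (↭-sym π) , f
⊢var⇒⊨ (conv d e) eq with ⊢var⇒⊨ d eq
... | σ , Γ≡ , f = σ , Γ≡ , entails λ S → to (≈⇒⟦⟧⇔ e) ∘ apply f S
⊢var⇒⊨ (convΓ d Γ≈) eq with ⊢var⇒⊨ d eq | Γ≈
... | _ , refl , f | (refl , e) ∷ [] = _ , refl , entails λ S → apply f S ∘ from (≈⇒⟦⟧⇔ e)

⋀-elim : ∀ {Γ M} μ {β} → Γ ⊢ M ∶ ⋀ μ → β ∈ toList μ → Γ ⊢ M ∶ β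
⋀-elim (_ List⁺.∷ [])     d (here refl) = d
⋀-elim (_ List⁺.∷ _ ∷ _)  d (here refl) = ∧E₁ d
⋀-elim (_ List⁺.∷ β ∷ βs) d (there p)   = ⋀-elim (β List⁺.∷ βs) (∧E₂ d) p

⋀-intro : ∀ {Γ M} ν → (∀ {β} → β ∈ toList ν → Γ ⊢ M ∶ β) → Γ ⊢ M ∶ ⋀ ν
⋀-intro {Γ} {M} (β List⁺.∷ βs) = go β βs
  where
  go : ∀ β βs → (∀ {γ} → γ ∈ β ∷ βs → Γ ⊢ M ∶ γ) → Γ ⊢ M ∶ ⋀ (β List⁺.∷ βs)
  go β []       f = f (here refl)
  go β (γ ∷ γs) f = ∧I (f (here refl)) (go γ γs (f ∘ there))

mainTheorem11 : ∀ (x : Var) (σ τ : Ty) →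
    ((x , σ) ∷ []) ⊢ var x ∶ τ →
    ∀ μ → μ ∈ toList (w σ) →
    Σ _ λ ν → (ν ∈ toList (w τ)) ×
      (∀ {β} → β ∈ toList ν → β ∈ toList μ) ×
      (((x , ⋀ μ) ∷ []) ⊢ var x ∶ ⋀ ν)
mainTheorem11 x σ τ d μ μ∈ with ⊢var⇒⊨ d refl
... | _ , refl , σ⊨τ with ⟦⟧⇒∈-w τ (apply σ⊨τ (_∈ toList μ) (∈-w⇒⟦⟧ σ μ∈))
... | ν , ν∈ , ν⊆μ = ν , ν∈ , ν⊆μ , ⋀-intro ν (⋀-elim μ ax ∘ ν⊆μ)
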